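{- The saturation $\Delta^{\leadsto}$ of any finite sample set $\Delta$ is finite.
   Context: Basic terms are given by the grammar $t,u::=x\mid tu\mid t^{o}\mid t^{\ell}\mid t^{r}\mid \mathrm{id}\mid\bot$, where $x$ ranges over a countably infinite set of term variables. Let $\kappa$ range over a countably infinite set of time variables. Samples are purely syntactic objects given by the grammar $\alpha::=\kappa\mid t[\alpha]\mid \mathsf{s}(\alpha)\mid\mathsf{p}(\alpha)\mid\mathsf{last}(t)$, where $t$ ranges over basic terms. Let $\leadsto$ be the relation on samples generated by the following clauses (for all basic terms $t,u$ and samples $\alpha$): $t[\alpha]\leadsto\alpha$; $\mathsf{s}(\alpha)\leadsto\alpha$; $\mathsf{p}(\alpha)\leadsto\alpha$; $(tu)[\alpha]\leadsto t[u[\alpha]]$; $t^{o}[\alpha]\leadsto t[\alpha]$; $t^{r}[\alpha]\leadsto t[t^{r}[\alpha]]$ and $t^{r}[\alpha]\leadsto t[\mathsf{s}(t^{r}[\alpha])]$; $t^{\ell}[\alpha]\leadsto t[t^{\ell}[\alpha]]$ and $t^{\ell}[\alpha]\leadsto t[\mathsf{p}(t^{\ell}[\alpha])]$; $t[\alpha]\leadsto t[\mathsf{last}(t)]$. The saturation of a set $\Delta$ of samples is $\Delta^{\leadsto}:=\{\beta\mid \exists\alpha\in\Delta,\ \alpha\leadsto^*\beta\}$, where $\leadsto^*$ is the reflexive transitive closure of $\leadsto$. -}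

module Defs where

open import Data.Nat using (ℕ)
open import Data.List using (List)
open import Data.List.Membership.Propositional using (_∈_)
open import Data.Product using (∃; _×_)
open import Relation.Binary.Construct.Closure.ReflexiveTransitive using (Star)

data Term : Set where
  var  : ℕ → Term
  app  : Term → Term → Term
  _ᵒ   : Term → Term
  _ˡ   : Term → Term
  _ʳ   : Term → Term
  idT  : Term
  botT : Term

data Sample : Set where
  tvar : ℕ → Sample
  _[_] : Term → Sample → Sample
  s    : Sample → Sample
  p    : Sample → Sample
  last : Term → Sample

data _⇝_ : Sample → Sample → Set where
  sub     : ∀ t α → (t [ α ]) ⇝ α
  s-step  : ∀ α → s α ⇝ α
  p-step  : ∀ α → p α ⇝ α
  app-step : ∀ t u α → (app t u [ α ]) ⇝ (t [ u [ α ] ])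
  o-step  : ∀ t α → ((t ᵒ) [ α ]) ⇝ (t [ α ])
  r-step₁ : ∀ t α → ((t ʳ) [ α ]) ⇝ (t [ (t ʳ) [ α ] ])
  r-step₂ : ∀ t α → ((t ʳ) [ α ]) ⇝ (t [ s ((t ʳ) [ α ]) ])
  l-step₁ : ∀ t α → ((t ˡ) [ α ]) ⇝ (t [ (t ˡ) [ α ] ])
  l-step₂ : ∀ t α → ((t ˡ) [ α ]) ⇝ (t [ p ((t ˡ) [ α ]) ])
  last-step : ∀ t α → (t [ α ]) ⇝ (t [ last t ])

_⇝*_ : Sample → Sample → Set
_⇝*_ = Star _⇝_

Saturation : List Sample → Sample → Set
Saturation Δ β = ∃ λ α → α ∈ Δ × α ⇝* β

FiniteSet : (Sample → Set) → Set
FiniteSet P = ∃ λ (L : List Sample) → ∀ β → (P β → β ∈ L) × (β ∈ L → P β)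

{-# OPTIONS --safe #-}
module Submission where

-- A step either peels off a constructor, replaces the argument of t[α] by last(t), or unfolds
-- the head term t of t[α] into proper subterms of t, the only new material being the wrappers
-- s(-) and p(-) around t^r[α] and t^ℓ[α]. So everything reachable from t[α] is reachable from α
-- or lies in a finite list `above t α`, computed by recursion on t; the reachable samples of
-- each α thus form a list, and the saturation of Δ is enumerated by their union over α ∈ Δ.

open import Defs
open import Data.List using (List; []; _∷_; _++_; concatMap)
open import Data.List.Membership.Propositional using (_∈_; find; lose)
open import Data.List.Membership.Propositional.Properties
  using (∈-++⁺ˡ; ∈-++⁺ʳ; ∈-++⁻; ∈-concatMap⁺; ∈-concatMap⁻)
open import Data.List.Relation.Binary.Subset.Propositional using (_⊆_)
open import Data.List.Relation.Binary.Subset.Propositional.Properties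
  using (⊆-refl; ⊆-trans; xs⊆x∷xs; xs⊆xs++ys; xs⊆ys++xs; ∈-∷⁺ʳ)
open import Data.List.Relation.Unary.All as All using (All; []; _∷_)
open import Data.List.Relation.Unary.All.Properties using (++⁺)
open import Data.List.Relation.Unary.Any using (here; there)
open import Data.Product using (∃; _×_; _,_)
open import Data.Sum using ([_,_])
open import Relation.Binary.PropositionalEquality using (refl)
open import Relation.Binary.Construct.Closure.ReflexiveTransitive using (Star; ε; _◅_)

++-⊆ : {A : Set} {xs ys zs : List A} → xs ⊆ zs → ys ⊆ zs → xs ++ ys ⊆ zs
++-⊆ {xs = xs} xs⊆zs ys⊆zs x∈ = [ xs⊆zs , ys⊆zs ] (∈-++⁻ xs x∈)

module _ {A : Set} {_⟶_ : A → A → Set} (reach : A → List A) where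

  Star⇒∈-reach : (∀ a → a ∈ reach a) → (∀ {a b} → a ⟶ b → reach b ⊆ reach a) →
                 ∀ {a b} → Star _⟶_ a b → b ∈ reach a
  Star⇒∈-reach a∈reach step-⊆ {a} ε = a∈reach a
  Star⇒∈-reach a∈reach step-⊆ (a⟶c ◅ c⟶*b) =
    step-⊆ a⟶c (Star⇒∈-reach a∈reach step-⊆ c⟶*b)

  Star-from-⇔-∈-concatMap : (∀ a → All (Star _⟶_ a) (reach a)) →
                            (∀ {a b} → Star _⟶_ a b → b ∈ reach a) →
                            ∀ Δ b → ((∃ λ a → a ∈ Δ × Star _⟶_ a b) → b ∈ concatMap reach Δ)
                                  × (b ∈ concatMap reach Δ → ∃ λ a → a ∈ Δ × Star _⟶_ a b)
  Star-from-⇔-∈-concatMap sound complete Δ b =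
    (λ (a , a∈Δ , a⟶*b) → ∈-concatMap⁺ reach (lose a∈Δ (complete a⟶*b))) ,
    (λ b∈ → let a , a∈Δ , b∈reach = find (∈-concatMap⁻ reach b∈)
            in a , a∈Δ , All.lookup (sound a) b∈reach)

mutual
  unfold : Term → Sample → List Sample
  unfold t Y = t [ Y ] ∷ unfoldings t Y

  above : Term → Sample → List Sample
  above t Y = unfold t Y ++ unfold t (last t) ++ last t ∷ []

  unfoldings : Term → Sample → List Sample
  unfoldings (app u v) Y = above u (v [ Y ]) ++ above v Y
  unfoldings (u ᵒ) Y = above u Y
  unfoldings (u ʳ) Y = above u ((u ʳ) [ Y ]) ++ above u (s ((u ʳ) [ Y ])) ++ s ((u ʳ) [ Y ]) ∷ []
  unfoldings (u ˡ) Y = above u ((u ˡ) [ Y ]) ++ above u (p ((u ˡ) [ Y ])) ++ p ((u ˡ) [ Y ]) ∷ []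
  unfoldings _ Y = []

reachable : Sample → List Sample
reachable (tvar κ) = tvar κ ∷ []
reachable (t [ α ]) = above t α ++ reachable α
reachable (s α) = s α ∷ reachable α
reachable (p α) = p α ∷ reachable α
reachable (last t) = last t ∷ []

mutual
  unfold-sound : ∀ t Y → All (t [ Y ] ⇝*_) (unfold t Y)
  unfold-sound t Y = ε ∷ unfoldings-sound t Y

  above-sound : ∀ t Y → All (t [ Y ] ⇝*_) (above t Y)
  above-sound t Y =
    ++⁺ (unfold-sound t Y)
        (++⁺ (All.map (last-step t Y ◅_) (unfold-sound t (last t)))
             ((last-step t Y ◅ sub t (last t) ◅ ε) ∷ []))

  unfoldings-sound : ∀ t Y → All (t [ Y ] ⇝*_) (unfoldings t Y)
  unfoldings-sound (app u v) Y =
    All.map (app-step u v Y ◅_)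
      (++⁺ (above-sound u (v [ Y ])) (All.map (sub u (v [ Y ]) ◅_) (above-sound v Y)))
  unfoldings-sound (u ᵒ) Y = All.map (o-step u Y ◅_) (above-sound u Y)
  unfoldings-sound (u ʳ) Y =
    ++⁺ (All.map (r-step₁ u Y ◅_) (above-sound u X))
        (All.map (r-step₂ u Y ◅_) (++⁺ (above-sound u (s X)) ((sub u (s X) ◅ ε) ∷ [])))
    where X = (u ʳ) [ Y ]
  unfoldings-sound (u ˡ) Y =
    ++⁺ (All.map (l-step₁ u Y ◅_) (above-sound u X))
        (All.map (l-step₂ u Y ◅_) (++⁺ (above-sound u (p X)) ((sub u (p X) ◅ ε) ∷ [])))
    where X = (u ˡ) [ Y ]
  unfoldings-sound (var _) Y = []
  unfoldings-sound idT Y = []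
  unfoldings-sound botT Y = []

reachable-sound : ∀ α → All (α ⇝*_) (reachable α)
reachable-sound (tvar κ) = ε ∷ []
reachable-sound (t [ α ]) = ++⁺ (above-sound t α) (All.map (sub t α ◅_) (reachable-sound α))
reachable-sound (s α) = ε ∷ All.map (s-step α ◅_) (reachable-sound α)
reachable-sound (p α) = ε ∷ All.map (p-step α ◅_) (reachable-sound α)
reachable-sound (last t) = ε ∷ []

∈-reachable : ∀ α → α ∈ reachable α
∈-reachable (tvar κ) = here refl
∈-reachable (t [ α ]) = here refl
∈-reachable (s α) = here refl
∈-reachable (p α) = here refl
∈-reachable (last t) = here refl

unfoldings⊆reachable : ∀ t α → unfoldings t α ⊆ reachable (t [ α ])
unfoldings⊆reachable t α x∈ = ∈-++⁺ˡ (∈-++⁺ˡ (there x∈))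

reachable-arg⊆ : ∀ t α → reachable α ⊆ reachable (t [ α ])
reachable-arg⊆ t α = xs⊆ys++xs (reachable α) (above t α)

⇝-reachable-⊆ : ∀ {α β} → α ⇝ β → reachable β ⊆ reachable α
⇝-reachable-⊆ (sub t α) = reachable-arg⊆ t α
⇝-reachable-⊆ (s-step α) = xs⊆x∷xs (reachable α) (s α)
⇝-reachable-⊆ (p-step α) = xs⊆x∷xs (reachable α) (p α)
⇝-reachable-⊆ (app-step t u α) =
  ++-⊆ (⊆-trans (xs⊆xs++ys (above t (u [ α ])) (above u α)) (unfoldings⊆reachable (app t u) α))
       (++-⊆ (⊆-trans (xs⊆ys++xs (above u α) (above t (u [ α ])))
                      (unfoldings⊆reachable (app t u) α))
             (reachable-arg⊆ (app t u) α))
⇝-reachable-⊆ (o-step t α) = ++-⊆ (unfoldings⊆reachable (t ᵒ) α) (reachable-arg⊆ (t ᵒ) α)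
⇝-reachable-⊆ (r-step₁ t α) =
  ++-⊆ (⊆-trans (xs⊆xs++ys (above t X) _) (unfoldings⊆reachable (t ʳ) α)) ⊆-refl
  where X = (t ʳ) [ α ]
⇝-reachable-⊆ (r-step₂ t α) =
  ++-⊆ (⊆-trans (xs⊆xs++ys (above t (s X)) _) shifted)
       (∈-∷⁺ʳ (shifted (∈-++⁺ʳ (above t (s X)) (here refl))) ⊆-refl)
  where
  X = (t ʳ) [ α ]
  shifted : above t (s X) ++ s X ∷ [] ⊆ reachable X
  shifted = ⊆-trans (xs⊆ys++xs _ (above t X)) (unfoldings⊆reachable (t ʳ) α)
⇝-reachable-⊆ (l-step₁ t α) =
  ++-⊆ (⊆-trans (xs⊆xs++ys (above t X) _) (unfoldings⊆reachable (t ˡ) α)) ⊆-refl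
  where X = (t ˡ) [ α ]
⇝-reachable-⊆ (l-step₂ t α) =
  ++-⊆ (⊆-trans (xs⊆xs++ys (above t (p X)) _) shifted)
       (∈-∷⁺ʳ (shifted (∈-++⁺ʳ (above t (p X)) (here refl))) ⊆-refl)
  where
  X = (t ˡ) [ α ]
  shifted : above t (p X) ++ p X ∷ [] ⊆ reachable X
  shifted = ⊆-trans (xs⊆ys++xs _ (above t X)) (unfoldings⊆reachable (t ˡ) α)
⇝-reachable-⊆ (last-step t α) =
  ⊆-trans (++-⊆ {xs = above t (last t)}
                (++-⊆ (⊆-trans (xs⊆xs++ys (unfold t (last t)) _) last-part) last-part)
                (⊆-trans (xs⊆ys++xs (last t ∷ []) (unfold t (last t))) last-part))
          (xs⊆xs++ys (above t α) (reachable α))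
  where
  last-part : unfold t (last t) ++ last t ∷ [] ⊆ above t α
  last-part = xs⊆ys++xs _ (unfold t α)

⇝*⇒∈-reachable : ∀ {α β} → α ⇝* β → β ∈ reachable α
⇝*⇒∈-reachable = Star⇒∈-reach reachable ∈-reachable ⇝-reachable-⊆

lemma3p5 : (Δ : List Sample) → FiniteSet (Saturation Δ)
lemma3p5 Δ =
  concatMap reachable Δ ,
  Star-from-⇔-∈-concatMap reachable reachable-sound ⇝*⇒∈-reachable Δ
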